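{- Let $P,Q$ be finite posets with $|P|=p$, $|Q|=q$, let $D_\lambda=C_{\lambda_1}+\cdots+C_{\lambda_\ell}\in\mathfrak{D}_n$, let $R=P\oplus D_\lambda\oplus Q$ and $1\le k\le p+n+q$. Define a permutation $w$ of $\{1,\ldots,n\}$ by: (1) $w=\mathrm{id}$ if $k-1\le p$; (2) $w(a)=k-p+1-a$ for $1\le a\le k-p$ and $w(a)=a$ for $a>k-p$, if $p<k-1<p+n$; (3) $w=\rho\circ c^{\,k-p-n}$ if $p+n\le k-1$, where $\rho(a)=n+1-a$ and $c=(n\,n{ - }1\,\cdots\,2\,1)$ is the cycle with $c(a)=a-1$ for $2\le a\le n$ and $c(1)=n$. Then for every linear extension $f$ of $R$, if $(L_1,\ldots,L_\ell)$ is the ordered set partition of $I(f)$, the ordered set partition of $I(q_{k-1}(f))$ is $(w(L_1),\ldots,w(L_\ell))$.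
   Context: For a finite poset $X$ with $|X|=N$, a linear extension is a bijection $f:X\to\{1,\ldots,N\}$ with $f(a)<f(b)$ whenever $a<_X b$. For $1\le i\le N-1$ the Bender–Knuth involution $t_i$ swaps labels $i$ and $i+1$ if $f^{ -1}(i)$, $f^{ -1}(i+1)$ are incomparable, and does nothing otherwise. Products denote composition, rightmost first. $q_0=\mathrm{id}$, $q_i=t_1(t_2t_1)\cdots(t_it_{i-1}\cdots t_1)$. $X\oplus Y$: ordinal sum (all of $X$ below all of $Y$); $+$: disjoint union; $C_m$: $m$-element chain. For $n>1$, $\mathfrak{D}_n$ is the set of posets $C_{\lambda_1}+\cdots+C_{\lambda_\ell}$ with $\lambda\vdash n$, $\ell>1$. For a linear extension $f$ of $R$, $I(f)$ is the linear extension of $D_\lambda$ with $I(f)(x)=f(x)-p$. The ordered set partition of a linear extension $g$ of $D_\lambda$ is $(g(C_{\lambda_1}),\ldots,g(C_{\lambda_\ell}))$. -}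

module Defs where

open import Level using (0ℓ)
open import Data.Nat using (ℕ; zero; suc; _+_; _∸_; _≤_; _<_; _≤?_; _<?_; _≟_)
import Data.Nat.Properties
open import Data.Fin as F using (Fin; toℕ; fromℕ<)
open import Data.Fin.Permutation using (Permutation; transpose)
open import Data.Vec using (Vec; lookup; sum)
open import Data.Product using (Σ; _×_; _,_; ∃)
open import Data.Sum using (_⊎_; inj₁; inj₂)
open import Data.Unit using (⊤; tt)
open import Data.Empty using (⊥)
open import Function using (_↔_; Inverse; id; _∘_)
open import Function.Construct.Composition using (_↔-∘_)
open import Relation.Binary using (Rel; Decidable; IsDecStrictPartialOrder)
open import Relation.Binary.PropositionalEquality using (_≡_)
open import Relation.Nullary using (Dec; yes; no; ¬_)
open import Relation.Nullary.Decidable using (_⊎-dec_; _×-dec_)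

record FinPoset (N : ℕ) : Set₁ where
  field
    _≺_    : Rel (Fin N) 0ℓ
    isDSPO : IsDecStrictPartialOrder _≡_ _≺_
  open IsDecStrictPartialOrder isDSPO public using (_<?_)

Labeling : Set → ℕ → Set
Labeling A N = A ↔ Fin N

label : ∀ {A N} → Labeling A N → A → ℕ
label f x = suc (toℕ (Inverse.to f x))

IsLinExt : ∀ {A N} → Rel A 0ℓ → Labeling A N → Set
IsLinExt _<A_ f = ∀ {a b} → a <A b → label f a < label f b

-- Bender–Knuth involution t_i (i as in the paper, 1 ≤ i ≤ N-1);
-- for i outside this range it is (by convention) the identity.

module BK {A : Set} (_<A_ : Rel A 0ℓ) (_<A?_ : Decidable _<A_) where

  comparable? : (a b : A) → Dec ((a <A b) ⊎ (b <A a))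
  comparable? a b = (a <A? b) ⊎-dec (b <A? a)

  t : ∀ {N} → ℕ → Labeling A N → Labeling A N
  t {N} zero f = f
  t {N} (suc i) f with suc i <? N
  ... | no _ = f
  ... | yes i+1<N with comparable? (Inverse.from f (fromℕ< {i} (Data.Nat.Properties.<-trans (Data.Nat.Properties.n<1+n i) i+1<N)))
                                   (Inverse.from f (fromℕ< i+1<N))
  ...   | yes _ = f
  ...   | no  _ = transpose (fromℕ< {i} (Data.Nat.Properties.<-trans (Data.Nat.Properties.n<1+n i) i+1<N))
                            (fromℕ< i+1<N) ↔-∘ f

  σ : ∀ {N} → ℕ → Labeling A N → Labeling A N
  σ zero    f = f
  σ (suc j) f = t (suc j) (σ j f)

  -- q_0 = id,  q_i = t_1 (t_2 t_1) ⋯ (t_i ⋯ t_1)  (rightmost applied first)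
  qop : ∀ {N} → ℕ → Labeling A N → Labeling A N
  qop zero    f = f
  qop (suc i) f = qop i (σ (suc i) f)

IsPartitionOf : ∀ {ℓ} → ℕ → Vec ℕ ℓ → Set
IsPartitionOf {ℓ} n λs =
  (∀ j → 1 ≤ lookup λs j) ×
  (∀ (i j : Fin ℓ) → i F.≤ j → lookup λs j ≤ lookup λs i) ×
  sum λs ≡ n

DCarrier : ∀ {ℓ} → Vec ℕ ℓ → Set
DCarrier {ℓ} λs = Σ (Fin ℓ) (λ j → Fin (lookup λs j))

_<D_ : ∀ {ℓ} {λs : Vec ℕ ℓ} → Rel (DCarrier λs) 0ℓ
(j , a) <D (j′ , b) = (j ≡ j′) × (toℕ a < toℕ b)

_<D?_ : ∀ {ℓ} {λs : Vec ℕ ℓ} → Decidable (_<D_ {ℓ} {λs})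
(j , a) <D? (j′ , b) = (j F.≟ j′) ×-dec (toℕ a <? toℕ b)

RCarrier : ℕ → ∀ {ℓ} → Vec ℕ ℓ → ℕ → Set
RCarrier p λs q = Fin p ⊎ (DCarrier λs ⊎ Fin q)

module Ordinal {p q : ℕ} (P : FinPoset p) (Q : FinPoset q) {ℓ} (λs : Vec ℕ ℓ) where
  open FinPoset P renaming (_≺_ to _<P_; _<?_ to _<P?_)
  open FinPoset Q renaming (_≺_ to _<Q_; _<?_ to _<Q?_)

  _<R_ : Rel (RCarrier p λs q) 0ℓ
  inj₁ a        <R inj₁ b        = a <P b
  inj₁ _        <R inj₂ _        = ⊤
  inj₂ (inj₁ x) <R inj₂ (inj₁ y) = _<D_ {λs = λs} x y
  inj₂ (inj₁ _) <R inj₂ (inj₂ _) = ⊤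
  inj₂ (inj₂ a) <R inj₂ (inj₂ b) = a <Q b
  inj₂ (inj₁ _) <R inj₁ _        = ⊥
  inj₂ (inj₂ _) <R inj₁ _        = ⊥
  inj₂ (inj₂ _) <R inj₂ (inj₁ _) = ⊥

  _<R?_ : Decidable _<R_
  inj₁ a        <R? inj₁ b        = a <P? b
  inj₁ _        <R? inj₂ _        = yes tt
  inj₂ (inj₁ x) <R? inj₂ (inj₁ y) = _<D?_ {λs = λs} x y
  inj₂ (inj₁ _) <R? inj₂ (inj₂ _) = yes tt
  inj₂ (inj₂ a) <R? inj₂ (inj₂ b) = a <Q? b
  inj₂ (inj₁ _) <R? inj₁ _        = no (λ ())
  inj₂ (inj₂ _) <R? inj₁ _        = no (λ ())
  inj₂ (inj₂ _) <R? inj₂ (inj₁ _) = no (λ ())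

  open BK _<R_ _<R?_ public using (t; σ; qop)

  -- block j of the ordered set partition of I(f), where I(f)(x) = f(x) - p,
  -- as a predicate on labels m
  Block : ∀ {N} → Labeling (RCarrier p λs q) N → Fin ℓ → ℕ → Set
  Block f j m = Σ (Fin (lookup λs j)) (λ a → label f (inj₂ (inj₁ (j , a))) ∸ p ≡ m)

-- The permutation w of {1,…,n} (as a function on ℕ; only its values on
-- 1,…,n matter)

ρ : ℕ → ℕ → ℕ
ρ n a = suc n ∸ a

cyc : ℕ → ℕ → ℕ
cyc n zero          = zero
cyc n (suc zero)    = n
cyc n (suc (suc a)) = suc a

iter : ℕ → (ℕ → ℕ) → ℕ → ℕ
iter zero    g = id
iter (suc m) g = g ∘ iter m g

w : (p n k : ℕ) → ℕ → ℕ
w p n k a with k ≤? suc p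
... | yes _ = a
... | no _ with k ≤? p + n
...   | yes _ with a ≤? k ∸ p
...     | yes _ = suc (k ∸ p) ∸ a
...     | no _  = a
w p n k a | no _ | no _ = ρ n (iter (k ∸ (p + n)) (cyc n) a)

Image : (ℕ → ℕ) → (ℕ → Set) → ℕ → Set
Image g L m = Σ ℕ (λ a → L a × g a ≡ m)

{-# OPTIONS --safe #-}
-- A linear extension of R = P ⊕ D_λ ⊕ Q gives P the labels 1..p, D_λ the labels p+1..p+n
-- and Q the rest; a Bender–Knuth involution only exchanges incomparable elements, so it
-- preserves this layering. Hence t_i moves the labels I(f) = f − p of D_λ by the
-- transposition (i−p, i−p+1) when p < i < p+n and not at all otherwise; when t_i fixes f
-- inside this window, the two elements are comparable, i.e. in one chain, and the blocks
-- are still permuted by that transposition. So q_{k−1} acts on the ordered set partition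
-- by a product of transpositions: the sweep t_{p+b} ⋯ t_1 acts as the cycle
-- (b+1 b ⋯ 1), q_{p+b} as the reversal of 1..b+1, and every sweep past p+n adds the full
-- cycle c; comparing with the three cases of w finishes the proof.
module Submission where

open import Defs
open import Data.Nat using (ℕ; zero; suc; _+_; _∸_; _≤_; _<_; _≤?_; _<?_; _≟_; z≤n; s≤s)
open import Data.Nat.Properties
open import Level using (0ℓ)
open import Data.Fin as F using (Fin; toℕ; fromℕ<)
import Data.Fin.Permutation.Components as PC
open import Data.Fin.Properties using (toℕ-injective; toℕ<n; toℕ-fromℕ<; injective⇒≤)
open import Data.Product using (Σ; _×_; _,_; proj₁; proj₂)
open import Data.Sum using (_⊎_; inj₁; inj₂)
open import Data.Sum.Properties using (inj₁-injective; inj₂-injective)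
open import Data.Empty using (⊥-elim)
open import Data.Unit using (tt)
open import Data.Vec using (Vec; lookup)
open import Function using (id; _∘_; _⇔_; mk⇔; Inverse; Equivalence)
open import Function.Construct.Composition using (_↔-∘_)
open import Data.Fin.Permutation using (transpose)
open import Relation.Binary using (Rel; Decidable)
import Relation.Binary.Reasoning.Setoid as SetoidReasoning
open import Function.Properties.Equivalence using (⇔-setoid)
open import Relation.Binary.PropositionalEquality
open import Relation.Nullary using (Dec; yes; no; ¬_; _×-dec_)

Image-id : ∀ {B : ℕ → Set} m → B m ⇔ Image id B m
Image-id {B} m = mk⇔ (λ b → m , b , refl) (λ { (a , b , refl) → b })

Image-∘ : ∀ {h g : ℕ → ℕ} {B : ℕ → Set} m → Image h (Image g B) m ⇔ Image (h ∘ g) B m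
Image-∘ m = mk⇔ (λ { (_ , (a , b , refl) , e) → a , b , e })
                (λ { (a , b , e) → _ , (a , b , refl) , e })

Image-cong-map : ∀ {h h′ : ℕ → ℕ} {B : ℕ → Set} → (∀ x → B x → h x ≡ h′ x) →
                 ∀ m → Image h B m ⇔ Image h′ B m
Image-cong-map eq m = mk⇔ (λ { (a , b , e) → a , b , trans (sym (eq a b)) e })
                          (λ { (a , b , e) → a , b , trans (eq a b) e })

Image-cong-set : ∀ {h : ℕ → ℕ} {B B′ : ℕ → Set} → (∀ x → B x ⇔ B′ x) →
                 ∀ m → Image h B m ⇔ Image h B′ m
Image-cong-set eq m = mk⇔ (λ { (a , b , e) → a , Equivalence.to (eq a) b , e })
                          (λ { (a , b , e) → a , Equivalence.from (eq a) b , e })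

Image-involution : ∀ {h : ℕ → ℕ} {B : ℕ → Set} → (∀ x → h (h x) ≡ x) →
                   (∀ x → B x → B (h x)) → ∀ m → B m ⇔ Image h B m
Image-involution {h} {B} inv closed m =
  mk⇔ (λ b → h m , closed m b , inv m) (λ { (a , b , refl) → closed a b })

swap : ℕ → ℕ → ℕ
swap zero    zero          = 1
swap zero    (suc zero)    = 0
swap zero    (suc (suc v)) = suc (suc v)
swap (suc i) zero          = zero
swap (suc i) (suc v)       = suc (swap i v)

swap-self : ∀ i → swap i i ≡ suc i
swap-self zero    = refl
swap-self (suc i) = cong suc (swap-self i)

swap-suc : ∀ i → swap i (suc i) ≡ i
swap-suc zero    = refl
swap-suc (suc i) = cong suc (swap-suc i)

swap-other : ∀ i {v} → v ≢ i → v ≢ suc i → swap i v ≡ v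
swap-other zero    {zero}          v≢i _    = ⊥-elim (v≢i refl)
swap-other zero    {suc zero}      _   v≢1  = ⊥-elim (v≢1 refl)
swap-other zero    {suc (suc v)}   _   _    = refl
swap-other (suc i) {zero}          _   _    = refl
swap-other (suc i) {suc v}         v≢i v≢si =
  cong suc (swap-other i (v≢i ∘ cong suc) (v≢si ∘ cong suc))

swap-involutive : ∀ i v → swap i (swap i v) ≡ v
swap-involutive zero    zero          = refl
swap-involutive zero    (suc zero)    = refl
swap-involutive zero    (suc (suc v)) = refl
swap-involutive (suc i) zero          = refl
swap-involutive (suc i) (suc v)       = cong suc (swap-involutive i v)

swap-∸ : ∀ p {i v} → p ≤ i → p ≤ v → swap i v ∸ p ≡ swap (i ∸ p) (v ∸ p)
swap-∸ zero    _         _         = refl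
swap-∸ (suc p) (s≤s p≤i) (s≤s p≤v) = swap-∸ p p≤i p≤v

cycleUpTo : ℕ → ℕ → ℕ
cycleUpTo c x with x ≤? c
... | yes _ = cyc c x
... | no  _ = x

reverseUpTo : ℕ → ℕ → ℕ
reverseUpTo b x with x ≤? b
... | yes _ = ρ b x
... | no  _ = x

cycleUpTo-≤ : ∀ {c x} → x ≤ c → cycleUpTo c x ≡ cyc c x
cycleUpTo-≤ {c} {x} x≤c with x ≤? c
... | yes _  = refl
... | no x≰c = ⊥-elim (x≰c x≤c)

cycleUpTo-≰ : ∀ {c x} → ¬ x ≤ c → cycleUpTo c x ≡ x
cycleUpTo-≰ {c} {x} x≰c with x ≤? c
... | yes x≤c = ⊥-elim (x≰c x≤c)
... | no  _   = refl

reverseUpTo-≤ : ∀ {b x} → x ≤ b → reverseUpTo b x ≡ ρ b x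
reverseUpTo-≤ {b} {x} x≤b with x ≤? b
... | yes _  = refl
... | no x≰b = ⊥-elim (x≰b x≤b)

reverseUpTo-≰ : ∀ {b x} → ¬ x ≤ b → reverseUpTo b x ≡ x
reverseUpTo-≰ {b} {x} x≰b with x ≤? b
... | yes x≤b = ⊥-elim (x≰b x≤b)
... | no  _   = refl

cycleUpTo-one : ∀ x → cycleUpTo 1 x ≡ x
cycleUpTo-one zero          = refl
cycleUpTo-one (suc zero)    = refl
cycleUpTo-one (suc (suc x)) = refl

reverseUpTo-one : ∀ {x} → 1 ≤ x → reverseUpTo 1 x ≡ x
reverseUpTo-one {suc zero}    _ = refl
reverseUpTo-one {suc (suc x)} _ = refl

cyc-range : ∀ {n x} → 1 ≤ x → x ≤ n → 1 ≤ cyc n x × cyc n x ≤ n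
cyc-range {x = suc zero}    _ 1≤n = 1≤n , ≤-refl
cyc-range {x = suc (suc x)} _ x≤n = s≤s z≤n , ≤-trans (n≤1+n _) x≤n

cycleUpTo-positive : ∀ {c x} → 1 ≤ x → 1 ≤ cycleUpTo c x
cycleUpTo-positive {c} {x} 1≤x with x ≤? c
... | yes x≤c = proj₁ (cyc-range 1≤x x≤c)
... | no  _   = 1≤x

swap-cycleUpTo : ∀ c x → swap (suc c) (cycleUpTo (suc c) x) ≡ cycleUpTo (suc (suc c)) x
swap-cycleUpTo c zero          = refl
swap-cycleUpTo c (suc zero)    = swap-self (suc c)
swap-cycleUpTo c (suc (suc x)) with suc (suc x) ≤? suc c | x ≟ c
... | yes x<c | _ = begin
  swap (suc c) (suc x)             ≡⟨ swap-other (suc c) (<⇒≢ x<c) (<⇒≢ (m<n⇒m<1+n x<c)) ⟩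
  suc x                            ≡⟨ cycleUpTo-≤ (≤-trans x<c (n≤1+n _)) ⟨
  cycleUpTo (suc (suc c)) (suc (suc x)) ∎
  where open ≡-Reasoning
... | no _ | yes refl = trans (swap-suc (suc c)) (sym (cycleUpTo-≤ {suc (suc c)} ≤-refl))
... | no x≮c | no x≢c = trans (swap-other (suc c) (λ e → x≮c (≤-reflexive e)) (x≢c ∘ suc-injective ∘ suc-injective))
                                (sym (cycleUpTo-≰ (λ x≤c → x≮c (s≤s (≤∧≢⇒< (≤-pred (≤-pred x≤c)) x≢c)))))

reverseUpTo-cycleUpTo : ∀ c {x} → 1 ≤ x → reverseUpTo c (cycleUpTo (suc c) x) ≡ reverseUpTo (suc c) x
reverseUpTo-cycleUpTo c {suc zero}    _ = trans (reverseUpTo-≰ (<-irrefl refl)) (sym (reverseUpTo-≤ (s≤s z≤n)))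
reverseUpTo-cycleUpTo c {suc (suc x)} _ with suc (suc x) ≤? suc c
... | yes x<c = reverseUpTo-≤ (≤-pred x<c)
... | no  x≮c = reverseUpTo-≰ (λ x≤c → x≮c (≤-trans x≤c (n≤1+n c)))

iter-comm : ∀ e (g : ℕ → ℕ) x → iter e g (g x) ≡ g (iter e g x)
iter-comm zero    g x = refl
iter-comm (suc e) g x = cong g (iter-comm e g x)

-- Indices are written b + p (not p + b) so that suc b + p computes to suc (b + p).
module WindowAction (p n : ℕ) where

  -- The effect of t_i on the labels I(f) = f − p of D_λ.
  stepAction : ℕ → ℕ → ℕ
  stepAction i with p <? i | i <? p + n
  ... | yes _ | yes _ = swap (i ∸ p)
  ... | _     | _     = id

  sweepAction : ℕ → ℕ → ℕ
  sweepAction zero    = id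
  sweepAction (suc j) = stepAction (suc j) ∘ sweepAction j

  qAction : ℕ → ℕ → ℕ
  qAction zero    = id
  qAction (suc i) = qAction i ∘ sweepAction (suc i)

  stepAction-inside : ∀ {i} → p < i → i < p + n → stepAction i ≡ swap (i ∸ p)
  stepAction-inside {i} p<i i<p+n with p <? i | i <? p + n
  ... | yes _   | yes _      = refl
  ... | no p≮i  | _          = ⊥-elim (p≮i p<i)
  ... | yes _   | no i≮p+n   = ⊥-elim (i≮p+n i<p+n)

  stepAction-outside : ∀ {i} → ¬ (p < i × i < p + n) → stepAction i ≡ id
  stepAction-outside {i} outside with p <? i | i <? p + n
  ... | yes p<i | yes i<p+n = ⊥-elim (outside (p<i , i<p+n))
  ... | no _    | _         = refl
  ... | yes _   | no _      = refl

  sweepAction-below : ∀ {j} → j ≤ p → ∀ x → sweepAction j x ≡ x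
  sweepAction-below {zero}  _   x = refl
  sweepAction-below {suc j} j<p x = begin
    stepAction (suc j) (sweepAction j x) ≡⟨ cong-app (stepAction-outside (λ (p<j , _) → <⇒≱ p<j j<p)) _ ⟩
    sweepAction j x                      ≡⟨ sweepAction-below (<⇒≤ j<p) x ⟩
    x                                    ∎
    where open ≡-Reasoning

  sweepAction-window : ∀ {b} → suc b ≤ n → ∀ x → sweepAction (b + p) x ≡ cycleUpTo (suc b) x
  sweepAction-window {zero}  _   x = trans (sweepAction-below ≤-refl x) (sym (cycleUpTo-one x))
  sweepAction-window {suc b} b<n x = begin
    stepAction (suc b + p) (sweepAction (b + p) x) ≡⟨ cong (stepAction (suc b + p)) (sweepAction-window (<⇒≤ b<n) x) ⟩
    stepAction (suc b + p) (cycleUpTo (suc b) x)   ≡⟨ cong-app (stepAction-inside p<sb+p sb+p<p+n) _ ⟩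
    swap (suc b + p ∸ p) (cycleUpTo (suc b) x)     ≡⟨ cong (λ i → swap i (cycleUpTo (suc b) x)) (m+n∸n≡m (suc b) p) ⟩
    swap (suc b) (cycleUpTo (suc b) x)             ≡⟨ swap-cycleUpTo b x ⟩
    cycleUpTo (suc (suc b)) x                      ∎
    where
    open ≡-Reasoning
    p<sb+p : p < suc b + p
    p<sb+p = s≤s (m≤n+m p b)
    sb+p<p+n : suc b + p < p + n
    sb+p<p+n = subst (_≤ p + n) (+-comm p (suc (suc b))) (+-monoʳ-≤ p b<n)

  sweepAction-above : ∀ {n′} → suc n′ ≡ n → ∀ e x → sweepAction (e + (n′ + p)) x ≡ cycleUpTo n x
  sweepAction-above {n′} refl zero    x = sweepAction-window ≤-refl x
  sweepAction-above {n′} refl (suc e) x = begin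
    stepAction (suc e + (n′ + p)) (sweepAction (e + (n′ + p)) x)
      ≡⟨ cong-app (stepAction-outside (λ (_ , i<p+n) → <⇒≱ i<p+n p+n≤i)) _ ⟩
    sweepAction (e + (n′ + p)) x                                  ≡⟨ sweepAction-above refl e x ⟩
    cycleUpTo n x                                                 ∎
    where
    open ≡-Reasoning
    p+n≤i : p + n ≤ suc e + (n′ + p)
    p+n≤i = subst (_≤ suc e + (n′ + p)) (+-comm (suc n′) p) (s≤s (m≤n+m (n′ + p) e))

  qAction-below : ∀ {i} → i ≤ p → ∀ x → qAction i x ≡ x
  qAction-below {zero}  _   x = refl
  qAction-below {suc i} i<p x =
    trans (cong (qAction i) (sweepAction-below i<p x)) (qAction-below (<⇒≤ i<p) x)

  qAction-window : ∀ {b} → suc b ≤ n → ∀ {x} → 1 ≤ x → qAction (b + p) x ≡ reverseUpTo (suc b) x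
  qAction-window {zero}  _   {x} 1≤x = trans (qAction-below ≤-refl x) (sym (reverseUpTo-one 1≤x))
  qAction-window {suc b} b<n {x} 1≤x = begin
    qAction (b + p) (sweepAction (suc b + p) x)     ≡⟨ cong (qAction (b + p)) (sweepAction-window b<n x) ⟩
    qAction (b + p) (cycleUpTo (suc (suc b)) x)     ≡⟨ qAction-window (<⇒≤ b<n) (cycleUpTo-positive 1≤x) ⟩
    reverseUpTo (suc b) (cycleUpTo (suc (suc b)) x) ≡⟨ reverseUpTo-cycleUpTo (suc b) 1≤x ⟩
    reverseUpTo (suc (suc b)) x                     ∎
    where open ≡-Reasoning

  qAction-above : ∀ {n′} → suc n′ ≡ n → ∀ e {x} → 1 ≤ x → x ≤ n →
                  qAction (e + (n′ + p)) x ≡ ρ n (iter e (cyc n) x)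
  qAction-above refl zero    1≤x x≤n = trans (qAction-window ≤-refl 1≤x) (reverseUpTo-≤ x≤n)
  qAction-above {n′} refl (suc e) {x} 1≤x x≤n = begin
    qAction (e + (n′ + p)) (sweepAction (suc e + (n′ + p)) x)
      ≡⟨ cong (qAction (e + (n′ + p))) (sweepAction-above refl (suc e) x) ⟩
    qAction (e + (n′ + p)) (cycleUpTo n x)                    ≡⟨ cong (qAction (e + (n′ + p))) (cycleUpTo-≤ x≤n) ⟩
    qAction (e + (n′ + p)) (cyc n x)                          ≡⟨ qAction-above refl e 1≤cx cx≤n ⟩
    ρ n (iter e (cyc n) (cyc n x))                            ≡⟨ cong (ρ n) (iter-comm e (cyc n) x) ⟩
    ρ n (iter (suc e) (cyc n) x)                              ∎
    where
    open ≡-Reasoning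
    1≤cx = proj₁ (cyc-range 1≤x x≤n)
    cx≤n = proj₂ (cyc-range 1≤x x≤n)

  w-below : ∀ {k a} → k ≤ suc p → w p n k a ≡ a
  w-below {k} k≤p with k ≤? suc p
  ... | yes _  = refl
  ... | no k≰p = ⊥-elim (k≰p k≤p)

  w-window : ∀ {k a} → ¬ k ≤ suc p → k ≤ p + n → w p n k a ≡ reverseUpTo (k ∸ p) a
  w-window {k} {a} k≰p k≤p+n with k ≤? suc p
  ... | yes k≤p = ⊥-elim (k≰p k≤p)
  ... | no _ with k ≤? p + n
  ...   | no k≰p+n = ⊥-elim (k≰p+n k≤p+n)
  ...   | yes _ with a ≤? k ∸ p
  ...     | yes _ = refl
  ...     | no  _ = refl

  w-above : ∀ {k a} → ¬ k ≤ suc p → ¬ k ≤ p + n → w p n k a ≡ ρ n (iter (k ∸ (p + n)) (cyc n) a)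
  w-above {k} k≰p k≰p+n with k ≤? suc p
  ... | yes k≤p = ⊥-elim (k≰p k≤p)
  ... | no _ with k ≤? p + n
  ...   | yes k≤p+n = ⊥-elim (k≰p+n k≤p+n)
  ...   | no  _     = refl

  qAction-w : ∀ k₀ {a} → 1 ≤ a → a ≤ n → qAction k₀ a ≡ w p n (suc k₀) a
  qAction-w k₀ {a} 1≤a a≤n = byRegime (suc k₀ ≤? suc p) (suc k₀ ≤? p + n)
    where
    open ≡-Reasoning
    byRegime : Dec (suc k₀ ≤ suc p) → Dec (suc k₀ ≤ p + n) → qAction k₀ a ≡ w p n (suc k₀) a
    byRegime (yes k≤p) _ = trans (qAction-below (≤-pred k≤p) a) (sym (w-below k≤p))
    byRegime (no k≰p) (yes k≤p+n) = begin
      qAction k₀ a                 ≡⟨ cong (λ i → qAction i a) k₀≡b+p ⟩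
      qAction (b + p) a            ≡⟨ qAction-window b<n 1≤a ⟩
      reverseUpTo (suc b) a        ≡⟨ cong (λ c → reverseUpTo c a) (+-∸-assoc 1 p≤k₀) ⟨
      reverseUpTo (suc k₀ ∸ p) a   ≡⟨ w-window k≰p k≤p+n ⟨
      w p n (suc k₀) a             ∎
      where
      p≤k₀ : p ≤ k₀
      p≤k₀ = <⇒≤ (≤-pred (≰⇒> k≰p))
      b = k₀ ∸ p
      k₀≡b+p : k₀ ≡ b + p
      k₀≡b+p = sym (m∸n+n≡m p≤k₀)
      b<n : suc b ≤ n
      b<n = +-cancelʳ-≤ p (suc b) n (subst₂ _≤_ (cong suc k₀≡b+p) (+-comm p n) k≤p+n)
    byRegime (no k≰p) (no k≰p+n) = begin
      qAction k₀ a                                ≡⟨ cong (λ i → qAction i a) k₀≡e+n′+p ⟩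
      qAction (e + (n′ + p)) a                    ≡⟨ qAction-above n′+1≡n e 1≤a a≤n ⟩
      ρ n (iter e (cyc n) a)                      ≡⟨ cong (λ i → ρ n (iter i (cyc n) a)) k-[p+n]≡e ⟨
      ρ n (iter (suc k₀ ∸ (p + n)) (cyc n) a)     ≡⟨ w-above k≰p k≰p+n ⟨
      w p n (suc k₀) a                            ∎
      where
      n′ = n ∸ 1
      n′+1≡n : suc n′ ≡ n
      n′+1≡n = m+[n∸m]≡n (≤-trans 1≤a a≤n)
      e = k₀ ∸ (n′ + p)
      n+p≡p+n : suc n′ + p ≡ p + n
      n+p≡p+n = trans (cong (_+ p) n′+1≡n) (+-comm n p)
      k₀≡e+n′+p : k₀ ≡ e + (n′ + p)
      k₀≡e+n′+p = sym (m∸n+n≡m (<⇒≤ (subst (_≤ k₀) (sym n+p≡p+n) (≤-pred (≰⇒> k≰p+n)))))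
      k-[p+n]≡e : suc k₀ ∸ (p + n) ≡ e
      k-[p+n]≡e = cong (suc k₀ ∸_) (sym n+p≡p+n)

toℕ-transpose : ∀ {M} (a b w : Fin M) → toℕ b ≡ suc (toℕ a) →
                toℕ (PC.transpose a b w) ≡ swap (toℕ a) (toℕ w)
toℕ-transpose a b w b≡a+1 with w F.≟ a
... | yes refl = trans b≡a+1 (sym (swap-self (toℕ a)))
... | no w≢a with w F.≟ b
...   | yes refl = sym (trans (cong (swap (toℕ a)) b≡a+1) (swap-suc (toℕ a)))
...   | no w≢b = sym (swap-other (toℕ a) (w≢a ∘ toℕ-injective) (λ e → w≢b (toℕ-injective (trans e (sym b≡a+1)))))

module _ {A : Set} {N : ℕ} (f : Labeling A N) where

  label-injective : ∀ {x y} → label f x ≡ label f y → x ≡ y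
  label-injective {x} {y} eq = begin
    x                                 ≡⟨ Inverse.strictlyInverseʳ f x ⟨
    Inverse.from f (Inverse.to f x)   ≡⟨ cong (Inverse.from f) (toℕ-injective (suc-injective eq)) ⟩
    Inverse.from f (Inverse.to f y)   ≡⟨ Inverse.strictlyInverseʳ f y ⟩
    y                                 ∎
    where open ≡-Reasoning

  label-≤ : ∀ x → label f x ≤ N
  label-≤ x = toℕ<n (Inverse.to f x)

  label-from : ∀ {r} (r<N : r < N) → label f (Inverse.from f (fromℕ< r<N)) ≡ suc r
  label-from r<N = trans (cong (suc ∘ toℕ) (Inverse.strictlyInverseˡ f (fromℕ< r<N)))
                         (cong suc (toℕ-fromℕ< r<N))

  label-transpose : ∀ {i} (i<N : i < N) (i+1<N : suc i < N) z →
                    label (transpose (fromℕ< i<N) (fromℕ< i+1<N) ↔-∘ f) z ≡ swap (suc i) (label f z)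
  label-transpose {i} i<N i+1<N z = cong suc (begin
    toℕ (PC.transpose (fromℕ< i<N) (fromℕ< i+1<N) (Inverse.to f z)) ≡⟨ toℕ-transpose _ _ _ next ⟩
    swap (toℕ (fromℕ< i<N)) (toℕ (Inverse.to f z))                  ≡⟨ cong (λ k → swap k (toℕ (Inverse.to f z))) (toℕ-fromℕ< i<N) ⟩
    swap i (toℕ (Inverse.to f z))                                    ∎)
    where
    open ≡-Reasoning
    next : toℕ (fromℕ< i+1<N) ≡ suc (toℕ (fromℕ< i<N))
    next = trans (toℕ-fromℕ< i+1<N) (cong suc (sym (toℕ-fromℕ< i<N)))

  labelled : ∀ {r} → r < N → Σ A λ x → label f x ≡ suc r
  labelled r<N = Inverse.from f (fromℕ< r<N) , label-from r<N

  window-injection⇒≤ : ∀ {m s c} (e : Fin m → A) → (∀ {i j} → e i ≡ e j → i ≡ j) →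
                       (∀ i → s < label f (e i) × label f (e i) ≤ s + c) → m ≤ c
  window-injection⇒≤ {m} {s} {c} e e-injective inWindow = injective⇒≤ {f = offset} offset-injective
    where
    offset : Fin m → Fin c
    offset i = fromℕ< (subst (label f (e i) ∸ suc s <_) (m+n∸m≡n s c)
                         (∸-monoˡ-< (proj₂ (inWindow i)) (≤-pred (proj₁ (inWindow i)))))
    offset-injective : ∀ {i j} → offset i ≡ offset j → i ≡ j
    offset-injective {i} {j} eq = e-injective (label-injective (∸-cancelʳ-≡ (proj₁ (inWindow i)) (proj₁ (inWindow j))
      (trans (sym (toℕ-fromℕ< _)) (trans (cong toℕ eq) (toℕ-fromℕ< _)))))

  window-covering⇒≤ : ∀ {m s c} (e : Fin m → A) → s + c ≤ N →
                      (∀ x → s < label f x → label f x ≤ s + c → Σ (Fin m) λ i → e i ≡ x) → c ≤ m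
  window-covering⇒≤ {m} {s} {c} e s+c≤N covered = injective⇒≤ {f = preimage} preimage-injective
    where
    inWindow : (j : Fin c) → s + toℕ j < s + c
    inWindow j = +-monoʳ-< s (toℕ<n j)
    inside : (j : Fin c) → s + toℕ j < N
    inside j = <-≤-trans (inWindow j) s+c≤N
    element : Fin c → A
    element j = proj₁ (labelled (inside j))
    covers : ∀ j → Σ (Fin m) λ i → e i ≡ element j
    covers j = covered (element j) (subst (s <_) (sym (proj₂ (labelled (inside j)))) (s≤s (m≤m+n s (toℕ j))))
                                   (subst (_≤ s + c) (sym (proj₂ (labelled (inside j)))) (inWindow j))
    preimage : Fin c → Fin m
    preimage j = proj₁ (covers j)
    preimage-injective : ∀ {j k} → preimage j ≡ preimage k → j ≡ k
    preimage-injective {j} {k} eq = toℕ-injective (+-cancelˡ-≡ s _ _ (suc-injective (begin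
      suc (s + toℕ j)                     ≡⟨ proj₂ (labelled (inside j)) ⟨
      label f (element j)                 ≡⟨ cong (label f) (sym (proj₂ (covers j))) ⟩
      label f (e (preimage j))            ≡⟨ cong (label f ∘ e) eq ⟩
      label f (e (preimage k))            ≡⟨ cong (label f) (proj₂ (covers k)) ⟩
      label f (element k)                 ≡⟨ proj₂ (labelled (inside k)) ⟩
      suc (s + toℕ k)                     ∎)))
      where open ≡-Reasoning

module BenderKnuthStep {A : Set} (_<A_ : Rel A 0ℓ) (_<A?_ : Decidable _<A_) where
  open BK _<A_ _<A?_ using (t; comparable?)

  Comparable : A → A → Set
  Comparable x y = (x <A y) ⊎ (y <A x)

  data Step {N} (g : Labeling A N) (i : ℕ) : Labeling A N → Set where
    unmoved : (∀ {x y} → label g x ≡ i → label g y ≡ suc i → Comparable x y) → Step g i g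
    swapped : ∀ {g′ x y} → label g x ≡ i → label g y ≡ suc i → ¬ Comparable x y →
              (∀ z → label g′ z ≡ swap i (label g z)) → Step g i g′

  step : ∀ {N} i (g : Labeling A N) → Step g i (t i g)
  step zero g = unmoved (λ ())
  step {N} (suc i) g with suc i <? N
  ... | no i+1≮N = unmoved (λ {_} {y} _ ey → ⊥-elim (i+1≮N (subst (_≤ N) ey (label-≤ g y))))
  ... | yes i+1<N with comparable? (Inverse.from g (fromℕ< (<-trans (n<1+n i) i+1<N)))
                                  (Inverse.from g (fromℕ< i+1<N))
  ...   | yes comparable = unmoved λ ex ey →
            subst₂ Comparable (label-injective g (trans (label-from g (<-trans (n<1+n i) i+1<N)) (sym ex)))
                              (label-injective g (trans (label-from g i+1<N) (sym ey))) comparable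
  ...   | no incomparable = swapped (label-from g (<-trans (n<1+n i) i+1<N)) (label-from g i+1<N) incomparable
                                    (label-transpose g (<-trans (n<1+n i) i+1<N) i+1<N)

module OrdinalSum {p q : ℕ} (P : FinPoset p) (Q : FinPoset q) {ℓ} (λs : Vec ℕ ℓ) (n : ℕ) where
  open Ordinal P Q λs
  open BenderKnuthStep _<R_ _<R?_ using (Comparable; unmoved; swapped; step)
  open WindowAction p n

  R : Set
  R = RCarrier p λs q

  N : ℕ
  N = p + n + q

  Lab : Set
  Lab = Labeling R N

  D : DCarrier λs → R
  D d = inj₂ (inj₁ d)

  data Layer : Set where
    bottom middle top : Layer

  layer : R → Layer
  layer (inj₁ _)        = bottom
  layer (inj₂ (inj₁ _)) = middle
  layer (inj₂ (inj₂ _)) = top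

  floor ceiling : Layer → ℕ
  floor bottom  = 0
  floor middle  = p
  floor top     = p + n
  ceiling bottom = p
  ceiling middle = p + n
  ceiling top    = N

  InLayer : Layer → ℕ → Set
  InLayer L v = floor L < v × v ≤ ceiling L

  Layered : Lab → Set
  Layered g = ∀ z → InLayer (layer z) (label g z)

  incomparable⇒same-layer : ∀ {x y} → ¬ Comparable x y → layer x ≡ layer y
  incomparable⇒same-layer {inj₁ _}        {inj₁ _}        _  = refl
  incomparable⇒same-layer {inj₁ _}        {inj₂ _}        nc = ⊥-elim (nc (inj₁ tt))
  incomparable⇒same-layer {inj₂ _}        {inj₁ _}        nc = ⊥-elim (nc (inj₂ tt))
  incomparable⇒same-layer {inj₂ (inj₁ _)} {inj₂ (inj₁ _)} _  = refl
  incomparable⇒same-layer {inj₂ (inj₁ _)} {inj₂ (inj₂ _)} nc = ⊥-elim (nc (inj₁ tt))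
  incomparable⇒same-layer {inj₂ (inj₂ _)} {inj₂ (inj₁ _)} nc = ⊥-elim (nc (inj₂ tt))
  incomparable⇒same-layer {inj₂ (inj₂ _)} {inj₂ (inj₂ _)} _  = refl

  comparable⇒same-chain : ∀ {j a j′ a′} → Comparable (D (j , a)) (D (j′ , a′)) → j ≡ j′
  comparable⇒same-chain (inj₁ (j≡j′ , _)) = j≡j′
  comparable⇒same-chain (inj₂ (j′≡j , _)) = sym j′≡j

  middle-labelled : ∀ {g v} → Layered g → p < v → v ≤ p + n → Σ (DCarrier λs) λ d → label g (D d) ≡ v
  middle-labelled {g} {suc r} layered p<v v≤p+n = inMiddle (labelled g (<-≤-trans v≤p+n (m≤m+n (p + n) q)))
    where
    inMiddle : Σ R (λ z → label g z ≡ suc r) → Σ (DCarrier λs) λ d → label g (D d) ≡ suc r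
    inMiddle (inj₁ a , e)        = ⊥-elim (<⇒≱ p<v (subst (_≤ p) e (proj₂ (layered (inj₁ a)))))
    inMiddle (inj₂ (inj₁ d) , e) = d , e
    inMiddle (inj₂ (inj₂ b) , e) = ⊥-elim (<⇒≱ (subst (p + n <_) e (proj₁ (layered (inj₂ (inj₂ b))))) v≤p+n)

  linearExtension⇒layered : ∀ {f} → IsLinExt _<R_ f → Layered f
  linearExtension⇒layered {f} below = λ where
      (inj₁ a)        → s≤s z≤n , bottom≤p a
      (inj₂ (inj₁ d)) → p<middle d , middle≤p+n d
      (inj₂ (inj₂ b)) → p+n<top b , label-≤ f _
    where
    bottom≤p : ∀ a → label f (inj₁ a) ≤ p
    bottom≤p a = window-covering⇒≤ f inj₁ (label-≤ f _) onlyBottom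
      where
      onlyBottom : ∀ x → 0 < label f x → label f x ≤ label f (inj₁ a) → Σ (Fin p) λ b → inj₁ b ≡ x
      onlyBottom (inj₁ b) _ _     = b , refl
      onlyBottom (inj₂ x) _ x≤a   = ⊥-elim (<⇒≱ (below {inj₁ a} {inj₂ x} tt) x≤a)

    p<middle : ∀ d → p < label f (D d)
    p<middle d = s≤s (window-injection⇒≤ f inj₁ inj₁-injective
                        (λ a → s≤s z≤n , ≤-pred (below {inj₁ a} {D d} tt)))

    middle≤p+n : ∀ d → label f (D d) ≤ p + n
    middle≤p+n d = +-cancelʳ-≤ q _ _ (begin
      label f (D d) + q                     ≤⟨ +-monoʳ-≤ (label f (D d)) q≤rest ⟩
      label f (D d) + (N ∸ label f (D d))   ≡⟨ m+[n∸m]≡n (label-≤ f (D d)) ⟩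
      N                                     ∎)
      where
      open ≤-Reasoning
      q≤rest : q ≤ N ∸ label f (D d)
      q≤rest = window-injection⇒≤ f (inj₂ ∘ inj₂) (inj₂-injective ∘ inj₂-injective)
        (λ b → below {D d} {inj₂ (inj₂ b)} tt ,
               subst (label f (inj₂ (inj₂ b)) ≤_) (sym (m+[n∸m]≡n (label-≤ f (D d)))) (label-≤ f _))

    p+n<top : ∀ b → p + n < label f (inj₂ (inj₂ b))
    p+n<top b = s≤s (+-cancelʳ-≤ q _ _ (begin
      N                ≤⟨ m≤n+m∸n N rank ⟩
      rank + (N ∸ rank) ≤⟨ +-monoʳ-≤ rank rest≤q ⟩
      rank + q         ∎))
      where
      open ≤-Reasoning
      rank = label f (inj₂ (inj₂ b)) ∸ 1
      rank+rest≡N : rank + (N ∸ rank) ≡ N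
      rank+rest≡N = m+[n∸m]≡n (≤-trans (n≤1+n rank) (label-≤ f _))
      onlyTop : ∀ x → rank < label f x → label f x ≤ rank + (N ∸ rank) → Σ (Fin q) λ c → inj₂ (inj₂ c) ≡ x
      onlyTop (inj₁ a)        b≤x _ = ⊥-elim (<⇒≱ (below {inj₁ a} {inj₂ (inj₂ b)} tt) b≤x)
      onlyTop (inj₂ (inj₁ d)) b≤x _ = ⊥-elim (<⇒≱ (below {D d} {inj₂ (inj₂ b)} tt) b≤x)
      onlyTop (inj₂ (inj₂ c)) _   _ = c , refl
      rest≤q : N ∸ rank ≤ q
      rest≤q = window-covering⇒≤ f (inj₂ ∘ inj₂) (≤-reflexive rank+rest≡N) onlyTop

  swapped-layered : ∀ {g g′ : Lab} {i x y} → Layered g → label g x ≡ i → label g y ≡ suc i → ¬ Comparable x y →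
                    (∀ z → label g′ z ≡ swap i (label g z)) → Layered g′
  swapped-layered {g} {g′} {i} {x} {y} layered ex ey nc relabel z with label g z ≟ i | label g z ≟ suc i
  ... | yes ez | _ = subst₂ InLayer (trans (sym (incomparable⇒same-layer nc)) (cong layer (sym z≡x)))
                                    (trans ey (sym (trans (relabel z) (trans (cong (swap i) ez) (swap-self i)))))
                                    (layered y)
    where z≡x = label-injective g (trans ez (sym ex))
  ... | no _ | yes ez = subst₂ InLayer (trans (incomparable⇒same-layer nc) (cong layer (sym z≡y)))
                                       (trans ex (sym (trans (relabel z) (trans (cong (swap i) ez) (swap-suc i)))))
                                       (layered x)
    where z≡y = label-injective g (trans ez (sym ey))
  ... | no z≢i | no z≢i+1 = subst (InLayer (layer z)) (sym (trans (relabel z) (swap-other i z≢i z≢i+1))) (layered z)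

  step-layered : ∀ i {g} → Layered g → Layered (t i g)
  step-layered i {g} layered with t i g | step i g
  ... | _  | unmoved _                = layered
  ... | g′ | swapped ex ey nc relabel = swapped-layered {g} {g′} layered ex ey nc relabel

  sweep-layered : ∀ k {g} → Layered g → Layered (σ k g)
  sweep-layered zero    layered = layered
  sweep-layered (suc k) layered = step-layered (suc k) (sweep-layered k layered)

  Block-relabel : ∀ {g g′ : Lab} {h : ℕ → ℕ} → (∀ d → label g′ (D d) ∸ p ≡ h (label g (D d) ∸ p)) →
                  ∀ j m → Block g′ j m ⇔ Image h (Block g j) m
  Block-relabel shift j m = mk⇔ (λ (a , e) → _ , (a , refl) , trans (sym (shift _)) e)
                                (λ { (_ , (a , refl) , e) → a , trans (shift _) e })

  inChain : ∀ {g : Lab} {j j′ v} → j ≡ j′ → (a′ : Fin (lookup λs j′)) → label g (D (j′ , a′)) ≡ v →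
            Σ (Fin (lookup λs j)) λ a → label g (D (j , a)) ≡ v
  inChain refl a′ e = a′ , e

  unmoved-partner : ∀ {g i} → Layered g → p < i → i < p + n →
                    (∀ {x y} → label g x ≡ i → label g y ≡ suc i → Comparable x y) →
                    ∀ j a → Σ (Fin (lookup λs j)) λ a′ → label g (D (j , a′)) ≡ swap i (label g (D (j , a)))
  unmoved-partner {g} {i} layered p<i i<p+n comparable j a with label g (D (j , a)) ≟ i | label g (D (j , a)) ≟ suc i
  ... | yes e | _ with middle-labelled {g} layered (<-trans p<i (n<1+n i)) i<p+n
  ...   | (j′ , a′) , e′ = inChain {g} (comparable⇒same-chain (comparable e e′)) a′
                             (trans e′ (sym (trans (cong (swap i) e) (swap-self i))))
  unmoved-partner {g} {i} layered p<i i<p+n comparable j a | no _ | yes e with middle-labelled {g} layered p<i (<⇒≤ i<p+n)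
  ...   | (j′ , a′) , e′ = inChain {g} (sym (comparable⇒same-chain (comparable e′ e))) a′
                             (trans e′ (sym (trans (cong (swap i) e) (swap-suc i))))
  unmoved-partner {g} {i} layered p<i i<p+n comparable j a | no ≢i | no ≢i+1 = a , sym (swap-other i ≢i ≢i+1)

  swapped-shift : ∀ {g g′ : Lab} {i x y} → Layered g → label g x ≡ i → label g y ≡ suc i → ¬ Comparable x y →
                  (∀ z → label g′ z ≡ swap i (label g z)) →
                  ∀ d → label g′ (D d) ∸ p ≡ stepAction i (label g (D d) ∸ p)
  swapped-shift {g} {g′} {i} {x} {y} layered ex ey nc relabel d with p <? i ×-dec i <? p + n
  ... | yes (p<i , i<p+n) = begin
    label g′ (D d) ∸ p               ≡⟨ cong (_∸ p) (relabel (D d)) ⟩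
    swap i (label g (D d)) ∸ p       ≡⟨ swap-∸ p (<⇒≤ p<i) (<⇒≤ (proj₁ (layered (D d)))) ⟩
    swap (i ∸ p) (label g (D d) ∸ p) ≡⟨ cong-app (stepAction-inside p<i i<p+n) _ ⟨
    stepAction i (label g (D d) ∸ p) ∎
    where open ≡-Reasoning
  ... | no outside = begin
    label g′ (D d) ∸ p               ≡⟨ cong (_∸ p) (trans (relabel (D d)) (swap-other i d≢x d≢y)) ⟩
    label g (D d) ∸ p                ≡⟨ cong-app (stepAction-outside outside) _ ⟨
    stepAction i (label g (D d) ∸ p) ∎
    where
    open ≡-Reasoning
    inMiddle : ∀ {z w} → z ≡ D d → layer z ≡ layer w → InLayer middle (label g w)
    inMiddle {w = w} refl same = subst (λ L → InLayer L (label g w)) (sym same) (layered w)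
    d≢x : label g (D d) ≢ i
    d≢x e = outside (subst (p <_) e (proj₁ (layered (D d))) ,
                     subst (_≤ p + n) ey (proj₂ (inMiddle x≡d (incomparable⇒same-layer nc))))
      where x≡d = label-injective g (trans ex (sym e))
    d≢y : label g (D d) ≢ suc i
    d≢y e = outside (subst (p <_) ex (proj₁ (inMiddle y≡d (sym (incomparable⇒same-layer nc)))) ,
                     subst (_≤ p + n) e (proj₂ (layered (D d))))
      where y≡d = label-injective g (trans ey (sym e))

  -- If t_i fixes g although both labels i, i+1 lie in D_λ, their elements are comparable,
  -- hence in one chain, so every block is closed under the transposition.
  unmoved-block : ∀ {g : Lab} {i} → Layered g →
                  (∀ {x y} → label g x ≡ i → label g y ≡ suc i → Comparable x y) →
                  ∀ j m → Block g j m ⇔ Image (stepAction i) (Block g j) m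
  unmoved-block {g} {i} layered comparable j m with p <? i ×-dec i <? p + n
  ... | yes (p<i , i<p+n) rewrite stepAction-inside p<i i<p+n = Image-involution (swap-involutive (i ∸ p)) closed m
    where
    closed : ∀ v → Block g j v → Block g j (swap (i ∸ p) v)
    closed _ (a , refl) with unmoved-partner {g} layered p<i i<p+n comparable j a
    ... | a′ , e = a′ , trans (cong (_∸ p) e) (swap-∸ p (<⇒≤ p<i) (<⇒≤ (proj₁ (layered (D (j , a))))))
  ... | no outside rewrite stepAction-outside {i} outside = Image-id m

  step-block : ∀ i {g} → Layered g → ∀ j m → Block (t i g) j m ⇔ Image (stepAction i) (Block g j) m
  step-block i {g} layered j m with t i g | step i g
  ... | _  | unmoved comparable       = unmoved-block {g} layered comparable j m
  ... | g′ | swapped ex ey nc relabel = Block-relabel {g} {g′} (swapped-shift {g} {g′} layered ex ey nc relabel) j m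

  sweep-block : ∀ k {g} → Layered g → ∀ j m → Block (σ k g) j m ⇔ Image (sweepAction k) (Block g j) m
  sweep-block zero        layered j m = Image-id m
  sweep-block (suc k) {g} layered j m = begin
    Block (t (suc k) (σ k g)) j m                                        ≈⟨ step-block (suc k) (sweep-layered k layered) j m ⟩
    Image (stepAction (suc k)) (Block (σ k g) j) m                       ≈⟨ Image-cong-set (λ v → sweep-block k layered j v) m ⟩
    Image (stepAction (suc k)) (Image (sweepAction k) (Block g j)) m     ≈⟨ Image-∘ m ⟩
    Image (stepAction (suc k) ∘ sweepAction k) (Block g j) m             ∎
    where open SetoidReasoning (⇔-setoid 0ℓ)

  q-block : ∀ k {g} → Layered g → ∀ j m → Block (qop k g) j m ⇔ Image (qAction k) (Block g j) m
  q-block zero        layered j m = Image-id m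
  q-block (suc k) {g} layered j m = begin
    Block (qop k (σ (suc k) g)) j m                                      ≈⟨ q-block k (sweep-layered (suc k) layered) j m ⟩
    Image (qAction k) (Block (σ (suc k) g) j) m                          ≈⟨ Image-cong-set (λ v → sweep-block (suc k) layered j v) m ⟩
    Image (qAction k) (Image (sweepAction (suc k)) (Block g j)) m        ≈⟨ Image-∘ m ⟩
    Image (qAction k ∘ sweepAction (suc k)) (Block g j) m                ∎
    where open SetoidReasoning (⇔-setoid 0ℓ)

  Block-range : ∀ {g j m} → Layered g → Block g j m → 1 ≤ m × m ≤ n
  Block-range {g} {j} layered (a , refl) =
    m<n⇒0<n∸m (proj₁ inLayer) , subst (label g (D (j , a)) ∸ p ≤_) (m+n∸m≡n p n) (∸-monoˡ-≤ p (proj₂ inLayer))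
    where inLayer = layered (D (j , a))

lemma4p6 : ∀ {p q ℓ} (P : FinPoset p) (Q : FinPoset q) (λs : Vec ℕ ℓ) (n : ℕ)
    → IsPartitionOf n λs → 1 < ℓ
    → (k : ℕ) → 1 ≤ k → k ≤ p + n + q
    → (f : Labeling (RCarrier p λs q) (p + n + q))
    → IsLinExt (Ordinal._<R_ P Q λs) f
    → (j : Fin ℓ) (m : ℕ)
    → Ordinal.Block P Q λs (Ordinal.qop P Q λs (k ∸ 1) f) j m
      ⇔ Image (w p n k) (Ordinal.Block P Q λs f j) m
lemma4p6 {p} P Q λs n _ _ (suc k₀) _ _ f linExt j m = begin
  Block (qop k₀ f) j m                 ≈⟨ q-block k₀ layered j m ⟩
  Image (qAction k₀) (Block f j) m     ≈⟨ Image-cong-map qAction≡w m ⟩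
  Image (w p n (suc k₀)) (Block f j) m ∎
  where
  open Ordinal P Q λs
  open OrdinalSum P Q λs n
  open WindowAction p n
  open SetoidReasoning (⇔-setoid 0ℓ)
  layered : Layered f
  layered = linearExtension⇒layered {f} linExt
  qAction≡w : ∀ a → Block f j a → qAction k₀ a ≡ w p n (suc k₀) a
  qAction≡w a a∈L = let 1≤a , a≤n = Block-range {f} layered a∈L in qAction-w k₀ 1≤a a≤n
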